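{- Let $G$ be a lattice-ordered Abelian group with strong unit $u$, and let $A=\Gamma(G,u)$. Let $L$ be a BL-algebra whose MV-center is the two-element Boolean algebra $\{0,1\}$. 1. If $f:A\to L$ is a homomorphism of BL-algebras, then for every $a\in A$: if $2a\le u$ then $f(a)=0$, and if $u\le 2a$ then $f(a)=1$. 2. There is a unique homomorphism of BL-algebras $g:L\to A$.
   Context: A BL-algebra is an algebra $(L,\wedge,\vee,\otimes,\to,0,1)$ such that $(L,\wedge,\vee,0,1)$ is a bounded lattice, $(L,\otimes,1)$ is a commutative monoid, $x\otimes y\le z$ iff $x\le y\to z$, $x\wedge y=x\otimes(x\to y)$, and $(x\to y)\vee(y\to x)=1$; a homomorphism of BL-algebras preserves $\wedge,\vee,\otimes,\to,0,1$. Put $\bar x=x\to0$; the MV-center of $L$ is $MV(L)=\{\bar x:x\in L\}$. A strong unit of a lattice-ordered Abelian group $G$ is an element $u\ge0$ such that for each $x\in G$ there is $n\ge1$ with $x\le nu$. $\Gamma(G,u)$ is the BL-algebra (indeed MV-algebra) $([0,u],\vee,\wedge,\otimes,\to,0,u)$ with $[0,u]=\{x\in G:0\le x\le u\}$, $x\otimes y=u-((2u-x-y)\wedge u)$ and $x\to y=(u-x+y)\wedge u$. -}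

module Defs where

open import Level using (Level; _⊔_; suc)
open import Data.Nat using (ℕ; zero) renaming (suc to sucℕ)
open import Data.Product using (Σ; ∃; _×_; proj₁)
open import Data.Sum using (_⊎_)
open import Relation.Nullary using (¬_)
open import Relation.Binary.Core using (Rel)
open import Algebra.Core using (Op₁; Op₂)
open import Algebra.Structures using (IsAbelianGroup; IsCommutativeMonoid)
open import Algebra.Lattice.Structures using (IsLattice)

record LAbelianGroup (c ℓ : Level) : Set (suc (c ⊔ ℓ)) where
  infix  4 _≈_ _≤_
  infixl 6 _+_
  infixr 7 _∧_
  infixr 6 _∨_
  field
    Carrier : Set c
    _≈_     : Rel Carrier ℓ
    _+_     : Op₂ Carrier
    0#      : Carrier
    -_      : Op₁ Carrier
    _∧_     : Op₂ Carrier
    _∨_     : Op₂ Carrier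
    isAbelianGroup : IsAbelianGroup _≈_ _+_ 0# -_
    isLattice      : IsLattice _≈_ _∨_ _∧_

  _≤_ : Rel Carrier ℓ
  x ≤ y = (x ∧ y) ≈ x

  field
    +-mono-≤ : ∀ x y z → x ≤ y → (x + z) ≤ (y + z)

  _·_ : ℕ → Carrier → Carrier
  zero   · x = 0#
  sucℕ n · x = x + (n · x)

record StrongUnit {c ℓ} (G : LAbelianGroup c ℓ) (u : LAbelianGroup.Carrier G) : Set (c ⊔ ℓ) where
  open LAbelianGroup G
  field
    nonneg  : 0# ≤ u
    bounds  : ∀ x → ∃ λ (n : ℕ) → x ≤ (sucℕ n · u)

module Γ {c ℓ} (G : LAbelianGroup c ℓ) (u : LAbelianGroup.Carrier G) where
  open LAbelianGroup G

  In : Carrier → Set ℓ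
  In x = (0# ≤ x) × (x ≤ u)

  -- elements of Γ(G,u); two elements are equal iff their underlying
  -- group elements are ≈-equal
  Elem : Set (c ⊔ ℓ)
  Elem = Σ Carrier In

  _⊗Γ_ : Op₂ Carrier
  x ⊗Γ y = u + - ((((u + u) + - x) + - y) ∧ u)

  _⇒Γ_ : Op₂ Carrier
  x ⇒Γ y = ((u + - x) + y) ∧ u

record BLAlgebra (c ℓ : Level) : Set (suc (c ⊔ ℓ)) where
  infix  4 _≈_ _≤_
  field
    Carrier : Set c
    _≈_     : Rel Carrier ℓ
    _∧_     : Op₂ Carrier
    _∨_     : Op₂ Carrier
    _⊗_     : Op₂ Carrier
    _⇒_     : Op₂ Carrier
    0L      : Carrier
    1L      : Carrier
    isLattice : IsLattice _≈_ _∨_ _∧_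

  _≤_ : Rel Carrier ℓ
  x ≤ y = (x ∧ y) ≈ x

  field
    0-least      : ∀ x → 0L ≤ x
    1-greatest   : ∀ x → x ≤ 1L
    ⊗-isCommutativeMonoid : IsCommutativeMonoid _≈_ _⊗_ 1L
    ⇒-cong       : ∀ {x x' y y'} → x ≈ x' → y ≈ y' → (x ⇒ y) ≈ (x' ⇒ y')
    residuation₁ : ∀ x y z → (x ⊗ y) ≤ z → x ≤ (y ⇒ z)
    residuation₂ : ∀ x y z → x ≤ (y ⇒ z) → (x ⊗ y) ≤ z
    divisibility : ∀ x y → (x ∧ y) ≈ (x ⊗ (x ⇒ y))
    prelinearity : ∀ x y → ((x ⇒ y) ∨ (y ⇒ x)) ≈ 1L

  ¬L : Carrier → Carrier
  ¬L x = x ⇒ 0L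

-- The MV-center MV(L) = { x̄ : x ∈ L } is the two-element Boolean
-- algebra {0,1}: 0 ≠ 1 and every x̄ is 0 or 1.
record MVCenterIsTwo {c ℓ} (L : BLAlgebra c ℓ) : Set (c ⊔ ℓ) where
  open BLAlgebra L
  field
    nontrivial : ¬ (0L ≈ 1L)
    twoValued  : ∀ x → (¬L x ≈ 0L) ⊎ (¬L x ≈ 1L)

record HomFromΓ {c ℓ c' ℓ'} (G : LAbelianGroup c ℓ) (u : LAbelianGroup.Carrier G)
                (L : BLAlgebra c' ℓ') : Set (c ⊔ ℓ ⊔ c' ⊔ ℓ') where
  open LAbelianGroup G renaming (_≈_ to _≈G_; _∧_ to _∧G_; _∨_ to _∨G_)
  open Γ G u
  open BLAlgebra L
  field
    fun      : Elem → BLAlgebra.Carrier L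
    cong     : ∀ (a b : Elem) → proj₁ a ≈G proj₁ b → fun a ≈ fun b
    pres-∧   : ∀ (a b z : Elem) → proj₁ z ≈G (proj₁ a ∧G proj₁ b) → fun z ≈ (fun a ∧ fun b)
    pres-∨   : ∀ (a b z : Elem) → proj₁ z ≈G (proj₁ a ∨G proj₁ b) → fun z ≈ (fun a ∨ fun b)
    pres-⊗   : ∀ (a b z : Elem) → proj₁ z ≈G (proj₁ a ⊗Γ proj₁ b) → fun z ≈ (fun a ⊗ fun b)
    pres-⇒   : ∀ (a b z : Elem) → proj₁ z ≈G (proj₁ a ⇒Γ proj₁ b) → fun z ≈ (fun a ⇒ fun b)
    pres-0   : ∀ (z : Elem) → proj₁ z ≈G 0# → fun z ≈ 0L
    pres-1   : ∀ (z : Elem) → proj₁ z ≈G u → fun z ≈ 1L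

record HomToΓ {c ℓ c' ℓ'} (G : LAbelianGroup c ℓ) (u : LAbelianGroup.Carrier G)
              (L : BLAlgebra c' ℓ') : Set (c ⊔ ℓ ⊔ c' ⊔ ℓ') where
  open LAbelianGroup G renaming (_≈_ to _≈G_; _∧_ to _∧G_; _∨_ to _∨G_)
  open Γ G u
  open BLAlgebra L
  field
    fun      : BLAlgebra.Carrier L → LAbelianGroup.Carrier G
    fun-In   : ∀ x → In (fun x)
    cong     : ∀ {x y} → x ≈ y → fun x ≈G fun y
    pres-∧   : ∀ x y → fun (x ∧ y) ≈G (fun x ∧G fun y)
    pres-∨   : ∀ x y → fun (x ∨ y) ≈G (fun x ∨G fun y)
    pres-⊗   : ∀ x y → fun (x ⊗ y) ≈G (fun x ⊗Γ fun y)
    pres-⇒   : ∀ x y → fun (x ⇒ y) ≈G (fun x ⇒Γ fun y)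
    pres-0   : fun 0L ≈G 0#
    pres-1   : fun 1L ≈G u

module Submission where

-- Since MV(L) = {0,1}, every x ∈ L is either 0 or "positive"
-- (x̄ = 0), and the positive elements are closed under ∧, ∨, ⊗ and
-- upwards (the case of ∧ is where prelinearity enters).  Hence
-- 'classify', sending 0 to false and positive elements to true, is a
-- homomorphism from L onto the two-element Boolean algebra, and
-- composing it with the embedding false ↦ 0, true ↦ u of the
-- two-element algebra into Γ(G,u) gives the homomorphism L → Γ(G,u).
-- It is unique because every homomorphism h satisfies h(x̄) = u - h(x).
-- For (1): if 2a ≤ u then a ⊗ a = 0 in Γ(G,u), so f(a) ⊗ f(a) = 0 and
-- f(a) = 0, as L has no nonzero elements of square zero; if u ≤ 2a then
-- 2(u - a) ≤ u, so f(u - a) = 0 and f(a) = f((u - a) → 0) = 0 → 0 = 1.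

open import Defs
open import Data.Bool.Base using (Bool; true; false; not)
  renaming (_∧_ to _∧ᵇ_; _∨_ to _∨ᵇ_)
open import Data.Product using (Σ; _×_; proj₁; proj₂; _,_)
open import Data.Sum using (_⊎_; inj₁; inj₂)
open import Data.Empty using (⊥; ⊥-elim)
open import Relation.Binary.Core using (Rel)
open import Relation.Binary.PropositionalEquality as ≡ using (_≡_)
open import Algebra.Core using (Op₂)
open import Algebra.Bundles using (AbelianGroup)
open import Algebra.Structures using (IsAbelianGroup; IsCommutativeMonoid)
open import Algebra.Lattice.Bundles using (Lattice)
open import Algebra.Lattice.Structures using (IsLattice)
import Algebra.Lattice.Properties.Lattice as LatticeProperties
import Algebra.Properties.AbelianGroup as AbelianGroupProperties
import Relation.Binary.Lattice as OrderTheoretic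
import Relation.Binary.Lattice.Properties.JoinSemilattice as JoinSemilatticeProperties
import Relation.Binary.Reasoning.Setoid as SetoidReasoning

-- The order  x ≤ y :⇔ x ∧ y ≈ x  of an algebraic lattice, as used for
-- both G and L, with the basic facts transported from the library's
-- order-theoretic view of a lattice (whose order is written x ≈ x ∧ y).
module LatticeOrder {a ℓ} {A : Set a} {_≈_ : Rel A ℓ} {_∨_ _∧_ : Op₂ A}
                    (isLattice : IsLattice _≈_ _∨_ _∧_) where
  open IsLattice isLattice using (sym; trans; ∧-cong; ∧-comm)

  private
    lattice : Lattice a ℓ
    lattice = record { isLattice = isLattice }
    module Ord = OrderTheoretic.Lattice
      (LatticeProperties.∨-∧-orderTheoreticLattice lattice)

  open LatticeProperties lattice public using (∨-idem)

  infix 4 _≤_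
  _≤_ : Rel A ℓ
  x ≤ y = (x ∧ y) ≈ x

  ≤-refl : ∀ {x} → x ≤ x
  ≤-refl = sym Ord.refl

  ≤-trans : ∀ {x y z} → x ≤ y → y ≤ z → x ≤ z
  ≤-trans p q = sym (Ord.trans (sym p) (sym q))

  ≤-antisym : ∀ {x y} → x ≤ y → y ≤ x → x ≈ y
  ≤-antisym p q = Ord.antisym (sym p) (sym q)

  ≤-resp-≈ : ∀ {x x' y y'} → x ≈ x' → y ≈ y' → x ≤ y → x' ≤ y'
  ≤-resp-≈ p q r = trans (∧-cong (sym p) (sym q)) (trans r p)

  x∧y≤x : ∀ x y → (x ∧ y) ≤ x
  x∧y≤x x y = sym (Ord.x∧y≤x x y)

  x∧y≤y : ∀ x y → (x ∧ y) ≤ y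
  x∧y≤y x y = sym (Ord.x∧y≤y x y)

  x≤x∨y : ∀ x y → x ≤ (x ∨ y)
  x≤x∨y x y = sym (Ord.x≤x∨y x y)

  y≤x∨y : ∀ x y → y ≤ (x ∨ y)
  y≤x∨y x y = sym (Ord.y≤x∨y x y)

  ≤⇒∧≈ʳ : ∀ {x y} → x ≤ y → (y ∧ x) ≈ x
  ≤⇒∧≈ʳ p = trans (∧-comm _ _) p

  ≤⇒∨≈ : ∀ {x y} → x ≤ y → (x ∨ y) ≈ y
  ≤⇒∨≈ p = JoinSemilatticeProperties.x≤y⇒x∨y≈y Ord.joinSemilattice (sym p)

module ΓArithmetic {c ℓ} (G : LAbelianGroup c ℓ) (u : LAbelianGroup.Carrier G)
                   (0≤u : LAbelianGroup._≤_ G (LAbelianGroup.0# G) u) where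
  open LAbelianGroup G hiding (_≤_)
  open IsAbelianGroup isAbelianGroup
    using (setoid; refl; sym; trans; assoc; comm; identityˡ; identityʳ; inverseʳ; ∙-cong; ⁻¹-cong)
  open LatticeOrder isLattice public
  open IsLattice isLattice using (∧-cong)
  open Γ G u
  open SetoidReasoning setoid

  private
    group : AbelianGroup c ℓ
    group = record { isAbelianGroup = isAbelianGroup }
  open AbelianGroupProperties group using (//-rightDividesˡ; //-rightDividesʳ; ⁻¹-anti-homo‿-; ε⁻¹≈ε; x∙y⁻¹≈ε⇒x≈y)

  +-congˡ : ∀ {x y z} → y ≈ z → x + y ≈ x + z
  +-congˡ p = ∙-cong refl p

  +-congʳ : ∀ {x y z} → y ≈ z → y + x ≈ z + x
  +-congʳ p = ∙-cong p refl

  x+[y-x]≈y : ∀ x y → x + (y + - x) ≈ y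
  x+[y-x]≈y x y = trans (comm x _) (//-rightDividesˡ x y)

  x-0≈x : ∀ x → x + - 0# ≈ x
  x-0≈x x = trans (+-congˡ ε⁻¹≈ε) (identityʳ x)

  [x+y]+[[z-x]-y]≈z : ∀ x y z → (x + y) + ((z + - x) + - y) ≈ z
  [x+y]+[[z-x]-y]≈z x y z = begin
    (x + y) + ((z + - x) + - y)   ≈⟨ assoc x y _ ⟩
    x + (y + ((z + - x) + - y))   ≈⟨ +-congˡ (x+[y-x]≈y y _) ⟩
    x + (z + - x)                 ≈⟨ x+[y-x]≈y x z ⟩
    z                             ∎

  u-[t∧u]≈0 : ∀ t → u ≤ t → u + - (t ∧ u) ≈ 0#
  u-[t∧u]≈0 t p = trans (+-congˡ (⁻¹-cong (≤⇒∧≈ʳ p))) (inverseʳ u)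

  ⊗Γ-zero : ∀ {x y} → (x + y) ≤ u → (x ⊗Γ y) ≈ 0#
  ⊗Γ-zero {x} {y} x+y≤u = u-[t∧u]≈0 _ u≤2u-x-y
    where
    u≤2u-x-y : u ≤ (((u + u) + - x) + - y)
    u≤2u-x-y = ≤-resp-≈ ([x+y]+[[z-x]-y]≈z x y u)
                        (trans (sym (assoc _ _ _)) (+-congʳ (sym (assoc _ _ _))))
                        (+-mono-≤ _ _ ((u + - x) + - y) x+y≤u)

  ⊗Γ-unit : (u ⊗Γ u) ≈ u
  ⊗Γ-unit = begin
    u + - ((((u + u) + - u) + - u) ∧ u)  ≈⟨ +-congˡ (⁻¹-cong (∧-cong 2u-u-u≈0 refl)) ⟩
    u + - (0# ∧ u)                       ≈⟨ +-congˡ (⁻¹-cong 0≤u) ⟩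
    u + - 0#                             ≈⟨ x-0≈x u ⟩
    u                                    ∎
    where
    2u-u-u≈0 : ((u + u) + - u) + - u ≈ 0#
    2u-u-u≈0 = trans (+-congʳ (//-rightDividesʳ u u)) (inverseʳ u)

  ⇒Γ-unit : ∀ {x y} → x ≤ y → (x ⇒Γ y) ≈ u
  ⇒Γ-unit {x} {y} x≤y = ≤⇒∧≈ʳ u≤u-x+y
    where
    u≤u-x+y : u ≤ ((u + - x) + y)
    u≤u-x+y = ≤-resp-≈ (x+[y-x]≈y x u) (comm y _) (+-mono-≤ _ _ (u + - x) x≤y)

  complement≈0⇒≈u : ∀ {x} → u + - x ≈ 0# → x ≈ u
  complement≈0⇒≈u {x} p = sym (x∙y⁻¹≈ε⇒x≈y u x p)

  complement-In : ∀ {x} → In x → In (u + - x)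
  complement-In {x} (0≤x , x≤u) =
      ≤-resp-≈ (inverseʳ x) refl (+-mono-≤ _ _ (- x) x≤u)
    , ≤-resp-≈ (identityˡ _) (x+[y-x]≈y x u) (+-mono-≤ _ _ (u + - x) 0≤x)

  ⇒Γ-zero : ∀ {x} → In x → (x ⇒Γ 0#) ≈ u + - x
  ⇒Γ-zero x∈ = trans (∧-cong (identityʳ _) refl) (proj₂ (complement-In x∈))

  complement-involutive : ∀ {x} → In x → ((u + - x) ⇒Γ 0#) ≈ x
  complement-involutive {x} x∈ = begin
    (u + - x) ⇒Γ 0#     ≈⟨ ⇒Γ-zero (complement-In x∈) ⟩
    u + - (u + - x)     ≈⟨ +-congˡ (⁻¹-anti-homo‿- u x) ⟩
    u + (x + - u)       ≈⟨ x+[y-x]≈y u x ⟩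
    x                   ∎

  complement-half : ∀ {x} → u ≤ (x + x) → ((u + - x) + (u + - x)) ≤ u
  complement-half {x} u≤2x =
    ≤-resp-≈ u+[[u-x]-x]≈2[u-x] ([x+y]+[[z-x]-y]≈z x x u) (+-mono-≤ _ _ ((u + - x) + - x) u≤2x)
    where
    u+[[u-x]-x]≈2[u-x] : u + ((u + - x) + - x) ≈ (u + - x) + (u + - x)
    u+[[u-x]-x]≈2[u-x] = begin
      u + ((u + - x) + - x)   ≈⟨ sym (assoc _ _ _) ⟩
      (u + (u + - x)) + - x   ≈⟨ +-congʳ (comm _ _) ⟩
      ((u + - x) + u) + - x   ≈⟨ assoc _ _ _ ⟩
      (u + - x) + (u + - x)   ∎

-- {0,u} is a subalgebra of Γ(G,u) isomorphic to the two-element Boolean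
-- algebra: 'embed' sends false to 0 and true to u and turns ∧, ∨, ⊗
-- (which is ∧ on Bool) and → (which is  a → b = not a ∨ b) into the
-- corresponding operations of Γ(G,u).
module TwoElementSubalgebra {c ℓ} (G : LAbelianGroup c ℓ) (u : LAbelianGroup.Carrier G)
                            (0≤u : LAbelianGroup._≤_ G (LAbelianGroup.0# G) u) where
  open LAbelianGroup G hiding (_≤_)
  open IsAbelianGroup isAbelianGroup using (refl; sym; trans; identityˡ; identityʳ; inverseʳ)
  open Γ G u
  open ΓArithmetic G u 0≤u

  embed : Bool → Carrier
  embed false = 0#
  embed true  = u

  embed-In : ∀ b → In (embed b)
  embed-In false = ≤-refl , 0≤u
  embed-In true  = 0≤u , ≤-refl

  embed-∧ : ∀ a b → embed (a ∧ᵇ b) ≈ (embed a ∧ embed b)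
  embed-∧ false b = sym (proj₁ (embed-In b))
  embed-∧ true  b = sym (≤⇒∧≈ʳ (proj₂ (embed-In b)))

  embed-∨ : ∀ a b → embed (a ∨ᵇ b) ≈ (embed a ∨ embed b)
  embed-∨ false b = sym (≤⇒∨≈ (proj₁ (embed-In b)))
  embed-∨ true  b = sym (trans (IsLattice.∨-comm isLattice _ _) (≤⇒∨≈ (proj₂ (embed-In b))))

  embed-⊗ : ∀ a b → embed (a ∧ᵇ b) ≈ (embed a ⊗Γ embed b)
  embed-⊗ false b     = sym (⊗Γ-zero (≤-resp-≈ (sym (identityˡ _)) refl (proj₂ (embed-In b))))
  embed-⊗ true  false = sym (⊗Γ-zero (≤-resp-≈ (sym (identityʳ u)) refl ≤-refl))
  embed-⊗ true  true  = sym ⊗Γ-unit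

  embed-⇒ : ∀ a b → embed (not a ∨ᵇ b) ≈ (embed a ⇒Γ embed b)
  embed-⇒ false b     = sym (⇒Γ-unit (proj₁ (embed-In b)))
  embed-⇒ true  false = sym (trans (⇒Γ-zero (embed-In true)) (inverseʳ u))
  embed-⇒ true  true  = sym (⇒Γ-unit ≤-refl)

module BLProperties {c ℓ} (L : BLAlgebra c ℓ) where
  open BLAlgebra L hiding (_≤_)
  open LatticeOrder isLattice public
  open IsLattice isLattice using (refl; sym; trans; ∧-comm)
  open IsCommutativeMonoid ⊗-isCommutativeMonoid using (setoid; identityˡ) renaming (comm to ⊗-comm)
  open SetoidReasoning setoid

  ≤0⇒≈0 : ∀ {x} → x ≤ 0L → x ≈ 0L
  ≤0⇒≈0 p = ≤-antisym p (0-least _)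

  1≤⇒≈1 : ∀ {x} → 1L ≤ x → x ≈ 1L
  1≤⇒≈1 p = ≤-antisym (1-greatest _) p

  ≤-zero : ∀ {x y} → x ≤ y → y ≈ 0L → x ≈ 0L
  ≤-zero p q = ≤0⇒≈0 (≤-resp-≈ refl q p)

  ¬-cong : ∀ {x y} → x ≈ y → ¬L x ≈ ¬L y
  ¬-cong p = ⇒-cong p refl

  -- ⊗ is monotone; this follows from residuation alone
  ⊗-monoˡ : ∀ {x y} z → x ≤ y → (x ⊗ z) ≤ (y ⊗ z)
  ⊗-monoˡ {x} {y} z p = residuation₂ x z (y ⊗ z) (≤-trans p (residuation₁ y z (y ⊗ z) ≤-refl))

  ⊗-monoʳ : ∀ {x y} z → x ≤ y → (z ⊗ x) ≤ (z ⊗ y)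
  ⊗-monoʳ z p = ≤-resp-≈ (⊗-comm _ _) (⊗-comm _ _) (⊗-monoˡ z p)

  -- since 1 is the top element and the unit of ⊗, products shrink
  x⊗y≤y : ∀ x y → (x ⊗ y) ≤ y
  x⊗y≤y x y = ≤-resp-≈ refl (identityˡ y) (⊗-monoˡ y (1-greatest x))

  x⊗y≤x : ∀ x y → (x ⊗ y) ≤ x
  x⊗y≤x x y = ≤-resp-≈ (⊗-comm y x) refl (x⊗y≤y y x)

  -- y ≤ x → y, because y ⊗ x ≤ y
  y≤x⇒y : ∀ x y → y ≤ (x ⇒ y)
  y≤x⇒y x y = residuation₁ y x y (x⊗y≤x y x)

  -- negation reverses the order, via modus ponens  x̄ ⊗ x ≤ 0
  ¬-antitone : ∀ {x y} → x ≤ y → ¬L y ≤ ¬L x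
  ¬-antitone {x} {y} p =
    residuation₁ (¬L y) x 0L (≤-trans (⊗-monoʳ (¬L y) p) (residuation₂ (¬L y) y 0L ≤-refl))

  -- 0 → x = 1, since 1 ⊗ 0 = 0 ≤ x; in particular 0̄ = 1
  0⇒x≈1 : ∀ x → (0L ⇒ x) ≈ 1L
  0⇒x≈1 x = 1≤⇒≈1 (residuation₁ 1L 0L x (≤-trans (x⊗y≤y 1L 0L) (0-least x)))

  ¬0≈1 : ¬L 0L ≈ 1L
  ¬0≈1 = 0⇒x≈1 0L

  -- 1̄ = 1 ⊗ (1 → 0) = 1 ∧ 0 = 0, by divisibility
  ¬1≈0 : ¬L 1L ≈ 0L
  ¬1≈0 = begin
    1L ⇒ 0L            ≈⟨ sym (identityˡ _) ⟩
    1L ⊗ (1L ⇒ 0L)     ≈⟨ sym (divisibility 1L 0L) ⟩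
    1L ∧ 0L            ≈⟨ ∧-comm 1L 0L ⟩
    0L ∧ 1L            ≈⟨ 0-least 1L ⟩
    0L                 ∎

  ⊗≈0⇒≤¬ : ∀ {x y} → (x ⊗ y) ≈ 0L → y ≤ ¬L x
  ⊗≈0⇒≤¬ {x} {y} p = residuation₁ y x 0L (≤-resp-≈ (sym (trans (⊗-comm y x) p)) refl ≤-refl)

  -- x̄ = 1 forces x = 1 ⊗ x ≤ 0
  ¬≈1⇒≈0 : ∀ {x} → ¬L x ≈ 1L → x ≈ 0L
  ¬≈1⇒≈0 {x} p =
    ≤0⇒≈0 (≤-resp-≈ (identityˡ x) refl (residuation₂ 1L x 0L (≤-resp-≈ refl (sym p) ≤-refl)))

  disjoint⇒[x⇒y]≤¬x : ∀ {x y} → (x ∧ y) ≈ 0L → (x ⇒ y) ≤ ¬L x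
  disjoint⇒[x⇒y]≤¬x {x} {y} p = ⊗≈0⇒≤¬ (trans (sym (divisibility x y)) p)

module TwoValuedCenter {c ℓ} (L : BLAlgebra c ℓ) (M : MVCenterIsTwo L) where
  open BLAlgebra L hiding (_≤_)
  open MVCenterIsTwo M
  open BLProperties L
  open IsLattice isLattice using (refl; sym; trans; ∧-comm; ∨-cong)

  Positive : Carrier → Set ℓ
  Positive x = ¬L x ≈ 0L

  zero-or-positive : ∀ x → (x ≈ 0L) ⊎ Positive x
  zero-or-positive x with twoValued x
  ... | inj₁ ¬x≈0 = inj₂ ¬x≈0
  ... | inj₂ ¬x≈1 = inj₁ (¬≈1⇒≈0 ¬x≈1)

  positive⇒≉0 : ∀ {x} → Positive x → x ≈ 0L → ⊥
  positive⇒≉0 x⁺ x≈0 = nontrivial (trans (sym x⁺) (trans (¬-cong x≈0) ¬0≈1))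

  positive-cong : ∀ {x y} → x ≈ y → Positive x → Positive y
  positive-cong p x⁺ = trans (¬-cong (sym p)) x⁺

  positive-≤ : ∀ {x y} → x ≤ y → Positive x → Positive y
  positive-≤ p x⁺ = ≤-zero (¬-antitone p) x⁺

  -- prelinearity: if x ∧ y were 0, both x → y and y → x would be 0
  ∧-positive : ∀ {x y} → Positive x → Positive y → Positive (x ∧ y)
  ∧-positive {x} {y} x⁺ y⁺ with zero-or-positive (x ∧ y)
  ... | inj₂ x∧y⁺ = x∧y⁺
  ... | inj₁ x∧y≈0 = ⊥-elim (nontrivial (sym (begin
    1L                     ≈⟨ sym (prelinearity x y) ⟩
    (x ⇒ y) ∨ (y ⇒ x)      ≈⟨ ∨-cong x⇒y≈0 y⇒x≈0 ⟩
    0L ∨ 0L                ≈⟨ ∨-idem 0L ⟩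
    0L                     ∎)))
    where
    open SetoidReasoning (IsCommutativeMonoid.setoid ⊗-isCommutativeMonoid)
    x⇒y≈0 : (x ⇒ y) ≈ 0L
    x⇒y≈0 = ≤-zero (disjoint⇒[x⇒y]≤¬x x∧y≈0) x⁺
    y⇒x≈0 : (y ⇒ x) ≈ 0L
    y⇒x≈0 = ≤-zero (disjoint⇒[x⇒y]≤¬x (trans (∧-comm y x) x∧y≈0)) y⁺

  -- if x ⊗ y were 0 then y ≤ x̄ = 0
  ⊗-positive : ∀ {x y} → Positive x → Positive y → Positive (x ⊗ y)
  ⊗-positive {x} {y} x⁺ y⁺ with zero-or-positive (x ⊗ y)
  ... | inj₂ x⊗y⁺ = x⊗y⁺
  ... | inj₁ x⊗y≈0 = ⊥-elim (positive⇒≉0 y⁺ (≤-zero (⊗≈0⇒≤¬ x⊗y≈0) x⁺))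

  square-zero : ∀ {x} → (x ⊗ x) ≈ 0L → x ≈ 0L
  square-zero {x} x⊗x≈0 with zero-or-positive x
  ... | inj₁ x≈0 = x≈0
  ... | inj₂ x⁺ = ⊥-elim (positive⇒≉0 (⊗-positive x⁺ x⁺) x⊗x≈0)

  ⇒-positive-of-zero : ∀ {x} y → x ≈ 0L → Positive (x ⇒ y)
  ⇒-positive-of-zero y x≈0 = positive-cong (sym (trans (⇒-cong x≈0 refl) (0⇒x≈1 y))) ¬1≈0

  ⇒-zero : ∀ {x y} → Positive x → y ≈ 0L → (x ⇒ y) ≈ 0L
  ⇒-zero x⁺ y≈0 = trans (⇒-cong refl y≈0) x⁺

  classify : Carrier → Bool
  classify x with zero-or-positive x
  ... | inj₁ _ = false
  ... | inj₂ _ = true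

  classify-zero : ∀ {x} → x ≈ 0L → classify x ≡ false
  classify-zero {x} x≈0 with zero-or-positive x
  ... | inj₁ _  = ≡.refl
  ... | inj₂ x⁺ = ⊥-elim (positive⇒≉0 x⁺ x≈0)

  classify-positive : ∀ {x} → Positive x → classify x ≡ true
  classify-positive {x} x⁺ with zero-or-positive x
  ... | inj₁ x≈0 = ⊥-elim (positive⇒≉0 x⁺ x≈0)
  ... | inj₂ _   = ≡.refl

  classify-cong : ∀ {x y} → x ≈ y → classify x ≡ classify y
  classify-cong {x} {y} p with zero-or-positive x
  ... | inj₁ x≈0 = ≡.sym (classify-zero (trans (sym p) x≈0))
  ... | inj₂ x⁺  = ≡.sym (classify-positive (positive-cong p x⁺))

  classify-0 : classify 0L ≡ false
  classify-0 = classify-zero refl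

  classify-1 : classify 1L ≡ true
  classify-1 = classify-positive ¬1≈0

  -- Matching on the dichotomy for x also computes 'classify x', so
  -- each law reduces to a fact about zero and positive elements.
  classify-∧ : ∀ x y → classify (x ∧ y) ≡ classify x ∧ᵇ classify y
  classify-∧ x y with zero-or-positive x | zero-or-positive y
  ... | inj₁ x≈0 | _ = classify-zero (≤-zero (x∧y≤x x y) x≈0)
  ... | inj₂ _ | inj₁ y≈0 = classify-zero (≤-zero (x∧y≤y x y) y≈0)
  ... | inj₂ x⁺ | inj₂ y⁺ = classify-positive (∧-positive x⁺ y⁺)

  classify-∨ : ∀ x y → classify (x ∨ y) ≡ classify x ∨ᵇ classify y
  classify-∨ x y with zero-or-positive x | zero-or-positive y
  ... | inj₂ x⁺ | _ = classify-positive (positive-≤ (x≤x∨y x y) x⁺)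
  ... | inj₁ _ | inj₂ y⁺ = classify-positive (positive-≤ (y≤x∨y x y) y⁺)
  ... | inj₁ x≈0 | inj₁ y≈0 = classify-zero (trans (∨-cong x≈0 y≈0) (∨-idem 0L))

  classify-⊗ : ∀ x y → classify (x ⊗ y) ≡ classify x ∧ᵇ classify y
  classify-⊗ x y with zero-or-positive x | zero-or-positive y
  ... | inj₁ x≈0 | _ = classify-zero (≤-zero (x⊗y≤x x y) x≈0)
  ... | inj₂ _ | inj₁ y≈0 = classify-zero (≤-zero (x⊗y≤y x y) y≈0)
  ... | inj₂ x⁺ | inj₂ y⁺ = classify-positive (⊗-positive x⁺ y⁺)

  classify-⇒ : ∀ x y → classify (x ⇒ y) ≡ not (classify x) ∨ᵇ classify y
  classify-⇒ x y with zero-or-positive x | zero-or-positive y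
  ... | inj₁ x≈0 | _ = classify-positive (⇒-positive-of-zero y x≈0)
  ... | inj₂ x⁺ | inj₁ y≈0 = classify-zero (⇒-zero x⁺ y≈0)
  ... | inj₂ _ | inj₂ y⁺ = classify-positive (positive-≤ (y≤x⇒y x y) y⁺)

module HomomorphismToΓ {c ℓ c' ℓ'} (G : LAbelianGroup c ℓ) (u : LAbelianGroup.Carrier G)
                       (0≤u : LAbelianGroup._≤_ G (LAbelianGroup.0# G) u)
                       (L : BLAlgebra c' ℓ') (M : MVCenterIsTwo L) where
  open LAbelianGroup G using (0#; -_) renaming (_≈_ to _≈G_; _+_ to _+G_)
  open IsAbelianGroup (LAbelianGroup.isAbelianGroup G) using () renaming (sym to symG; trans to transG)
  open BLAlgebra L using (Carrier; 0L; ¬L)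
  open Γ G u
  open ΓArithmetic G u 0≤u using (⇒Γ-zero; +-congˡ; complement≈0⇒≈u)
  open IsLattice (LAbelianGroup.isLattice G) using (∧-cong) renaming (refl to reflG)
  open TwoElementSubalgebra G u 0≤u
  open TwoValuedCenter L M

  toΓ : HomToΓ G u L
  toΓ = record
    { fun    = λ x → embed (classify x)
    ; fun-In = λ x → embed-In (classify x)
    ; cong   = λ p → via (classify-cong p)
    ; pres-∧ = λ x y → transG (via (classify-∧ x y)) (embed-∧ (classify x) (classify y))
    ; pres-∨ = λ x y → transG (via (classify-∨ x y)) (embed-∨ (classify x) (classify y))
    ; pres-⊗ = λ x y → transG (via (classify-⊗ x y)) (embed-⊗ (classify x) (classify y))
    ; pres-⇒ = λ x y → transG (via (classify-⇒ x y)) (embed-⇒ (classify x) (classify y))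
    ; pres-0 = via classify-0
    ; pres-1 = via classify-1
    }
    where
    via : ∀ {a b} → a ≡ b → embed a ≈G embed b
    via ≡.refl = reflG

  hom-¬ : (h : HomToΓ G u L) (x : Carrier) → HomToΓ.fun h (¬L x) ≈G u +G - HomToΓ.fun h x
  hom-¬ h x = transG (H.pres-⇒ x 0L) (transG (∧-cong (+-congˡ H.pres-0) reflG) (⇒Γ-zero (H.fun-In x)))
    where module H = HomToΓ h

  -- Hence every h agrees with toΓ: h(x) = h(0) = 0 when x = 0, and
  -- u - h(x) = h(x̄) = h(0) = 0 when x is positive.
  toΓ-unique : (h : HomToΓ G u L) (x : Carrier) → HomToΓ.fun h x ≈G HomToΓ.fun toΓ x
  toΓ-unique h x with zero-or-positive x
  ... | inj₁ x≈0 = transG (HomToΓ.cong h x≈0) (HomToΓ.pres-0 h)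
  ... | inj₂ x⁺  = complement≈0⇒≈u
        (transG (symG (hom-¬ h x)) (transG (HomToΓ.cong h x⁺) (HomToΓ.pres-0 h)))

module HomomorphismFromΓ {c ℓ c' ℓ'} (G : LAbelianGroup c ℓ) (u : LAbelianGroup.Carrier G)
                         (0≤u : LAbelianGroup._≤_ G (LAbelianGroup.0# G) u)
                         (L : BLAlgebra c' ℓ') (M : MVCenterIsTwo L)
                         (f : HomFromΓ G u L) where
  open LAbelianGroup G using (0#; -_) renaming (_≈_ to _≈G_; _+_ to _+G_; _≤_ to _≤G_)
  open IsAbelianGroup (LAbelianGroup.isAbelianGroup G) using () renaming (sym to symG; refl to reflG)
  open BLAlgebra L using (_≈_; _⇒_; 0L; 1L)
  open IsLattice (BLAlgebra.isLattice L) using (sym; trans)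
  open Γ G u
  open ΓArithmetic G u 0≤u using (≤-refl; ⊗Γ-zero; complement-In; complement-involutive; complement-half)
  open BLProperties L using (0⇒x≈1)
  open TwoValuedCenter L M using (square-zero)
  open HomFromΓ f

  zeroΓ : Elem
  zeroΓ = 0# , ≤-refl , 0≤u

  complementΓ : Elem → Elem
  complementΓ (a , a∈) = (u +G - a) , complement-In a∈

  f0≈0 : fun zeroΓ ≈ 0L
  f0≈0 = pres-0 zeroΓ reflG

  -- 2a ≤ u gives a ⊗ a = 0 in Γ(G,u), so f(a) ⊗ f(a) = 0 and f(a) = 0.
  half-below : ∀ a → (proj₁ a +G proj₁ a) ≤G u → fun a ≈ 0L
  half-below a 2a≤u = square-zero (trans (sym (pres-⊗ a a zeroΓ (symG (⊗Γ-zero 2a≤u)))) f0≈0)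

  -- u ≤ 2a gives f(u - a) = 0, and a = (u - a) → 0, so f(a) = 0 → 0 = 1.
  half-above : ∀ a → u ≤G (proj₁ a +G proj₁ a) → fun a ≈ 1L
  half-above a u≤2a = begin
    fun a                                   ≈⟨ pres-⇒ (complementΓ a) zeroΓ a a≈¬[u-a] ⟩
    fun (complementΓ a) ⇒ fun zeroΓ         ≈⟨ BLAlgebra.⇒-cong L f[u-a]≈0 f0≈0 ⟩
    0L ⇒ 0L                                 ≈⟨ 0⇒x≈1 0L ⟩
    1L                                      ∎
    where
    open SetoidReasoning (IsCommutativeMonoid.setoid (BLAlgebra.⊗-isCommutativeMonoid L))
    a≈¬[u-a] : proj₁ a ≈G (proj₁ (complementΓ a) ⇒Γ 0#)
    a≈¬[u-a] = symG (complement-involutive (proj₂ a))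
    f[u-a]≈0 : fun (complementΓ a) ≈ 0L
    f[u-a]≈0 = half-below (complementΓ a) (complement-half u≤2a)

lemma7p3 : ∀ {c ℓ c' ℓ'} (G : LAbelianGroup c ℓ) (u : LAbelianGroup.Carrier G) → StrongUnit G u → (L : BLAlgebra c' ℓ') → MVCenterIsTwo L →
    ((f : HomFromΓ G u L) → (a : Γ.Elem G u) →
        (LAbelianGroup._≤_ G (LAbelianGroup._+_ G (proj₁ a) (proj₁ a)) u → BLAlgebra._≈_ L (HomFromΓ.fun f a) (BLAlgebra.0L L))
      × (LAbelianGroup._≤_ G u (LAbelianGroup._+_ G (proj₁ a) (proj₁ a)) → BLAlgebra._≈_ L (HomFromΓ.fun f a) (BLAlgebra.1L L)))
    × Σ (HomToΓ G u L) (λ g → (h : HomToΓ G u L) → (x : BLAlgebra.Carrier L) → LAbelianGroup._≈_ G (HomToΓ.fun h x) (HomToΓ.fun g x))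
lemma7p3 G u su L M = (λ f a → Part1.half-below f a , Part1.half-above f a) , (toΓ , toΓ-unique)
  where
  -- only u ≥ 0 is used
  0≤u : LAbelianGroup._≤_ G (LAbelianGroup.0# G) u
  0≤u = StrongUnit.nonneg su
  module Part1 = HomomorphismFromΓ G u 0≤u L M
  open HomomorphismToΓ G u 0≤u L M using (toΓ; toΓ-unique)
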